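{- Let $(W,S)$ be a finite Coxeter system of rank $n$, $c$ a Coxeter element with reduced word $\mathbf{c}$, $k\geq 0$, $N=\ell(w_\circ)$, and write $\mathbf{c}^k\mathbf{w}_\circ(\mathbf{c})=(q_1,q_2,\dots,q_{kn+N})$. For $1\le i\le kn+N$ let $t_i=q_1q_2\cdots q_{i-1}q_iq_{i-1}\cdots q_2q_1\in W$. Then for indices $1\le \ell_1<\ell_2<\dots<\ell_{kn}\le kn+N$, the set of positions $\{\ell_1,\dots,\ell_{kn}\}$ is a facet of the multi-cluster complex $\Delta^k_c(W)$ if and only if $t_{\ell_{kn}}\cdots t_{\ell_2}t_{\ell_1}=c^k$.
   Context: A Coxeter element is the product of all elements of $S$ in some order; $w_\circ$ is the longest element. The $c$-sorting word $\mathbf{w}_\circ(\mathbf{c})$ is the lexicographically first (as a sequence of positions) subword of $\mathbf{c}\mathbf{c}\mathbf{c}\cdots$ which is a reduced expression for $w_\circ$. For a word $Q=(q_1,\dots,q_r)$ in $S$ and $\pi\in W$, the subword complex $\Delta(Q,\pi)$ is the simplicial complex on positions $\{1,\dots,r\}$ whose faces are the subsets $P$ such that the word obtained from $Q$ by deleting positions in $P$ contains a reduced expression for $\pi$ as a subword. $\Delta^k_c(W)=\Delta(\mathbf{c}^k\mathbf{w}_\circ(\mathbf{c}),w_\circ)$. -}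

module Defs where

open import Data.Nat using (ℕ; zero; suc; _≤_; _<_)
open import Data.Fin using (Fin; toℕ)
import Data.Fin as F
open import Data.List using (List; []; _∷_; _++_; length; lookup; take; reverse; map; concat; replicate)
open import Data.List.Membership.Propositional using (_∈_)
open import Data.List.Relation.Unary.Linked using (Linked)
import Data.List.Relation.Binary.Sublist.Propositional as SL
open import Data.Fin.Subset using (Subset; inside; outside) renaming (_⊆_ to _⊆ˢ_)
open import Data.Vec using ([]; _∷_)
open import Data.Product using (Σ; _×_; _,_; proj₂)
open import Data.Sum using (_⊎_)
open import Relation.Binary.PropositionalEquality using (_≡_; _≢_)

-- Coxeter systems of rank n, presented by a Coxeter matrix.
-- Finite Coxeter groups have all m(s,t) finite, so entries are in ℕ.

record CoxeterMatrix (n : ℕ) : Set where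
  field
    m       : Fin n → Fin n → ℕ
    m-diag  : ∀ i → m i i ≡ 1
    m-sym   : ∀ i j → m i j ≡ m j i
    m-off   : ∀ i j → i ≢ j → 2 ≤ m i j

open CoxeterMatrix public

Word : ℕ → Set
Word n = List (Fin n)

alt : ∀ {n} → Fin n → Fin n → ℕ → Word n
alt s t zero    = []
alt s t (suc k) = s ∷ alt t s k

data CoxRel {n} (M : CoxeterMatrix n) : Word n → Word n → Set where
  invol : ∀ s → CoxRel M (s ∷ s ∷ []) []
  braid : ∀ s t → CoxRel M (alt s t (m M s t)) (alt t s (m M s t))

-- the congruence generated by the relations: two words represent the same
-- element of W = ⟨ S | (st)^{m(s,t)} = e ⟩
infix 4 _≈⟨_⟩_
data _≈⟨_⟩_ {n} : Word n → CoxeterMatrix n → Word n → Set where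
  ≈step  : ∀ {M} u x y v → CoxRel M x y → (u ++ x ++ v) ≈⟨ M ⟩ (u ++ y ++ v)
  ≈refl  : ∀ {M w} → w ≈⟨ M ⟩ w
  ≈sym   : ∀ {M u v} → u ≈⟨ M ⟩ v → v ≈⟨ M ⟩ u
  ≈trans : ∀ {M u v w} → u ≈⟨ M ⟩ v → v ≈⟨ M ⟩ w → u ≈⟨ M ⟩ w

FiniteW : ∀ {n} → CoxeterMatrix n → Set
FiniteW {n} M = Σ (List (Word n)) λ L → ∀ w → Σ (Word n) λ u → u ∈ L × w ≈⟨ M ⟩ u

Reduced : ∀ {n} → CoxeterMatrix n → Word n → Set
Reduced {n} M w = ∀ (v : Word n) → v ≈⟨ M ⟩ w → length w ≤ length v

IsLongest : ∀ {n} → CoxeterMatrix n → Word n → Set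
IsLongest {n} M w0 = Reduced M w0 × (∀ (v : Word n) → Reduced M v → length v ≤ length w0)

-- a position in c c c ⋯ : (copy number j, index i inside the copy of c)
Pos : ∀ {n} → Word n → Set
Pos c = ℕ × Fin (length c)

_<P_ : ∀ {n} {c : Word n} → Pos c → Pos c → Set
(j , i) <P (j' , i') = j < j' ⊎ (j ≡ j' × toℕ i < toℕ i')

letters : ∀ {n} (c : Word n) → List (Pos c) → Word n
letters c ps = map (λ p → lookup c (proj₂ p)) ps

data LexLeq {n} (c : Word n) : List (Pos c) → List (Pos c) → Set where
  lex-nil : ∀ {ys} → LexLeq c [] ys
  lex-lt  : ∀ {x y xs ys} → _<P_ {c = c} x y → LexLeq c (x ∷ xs) (y ∷ ys)
  lex-eq  : ∀ {x xs ys} → LexLeq c xs ys → LexLeq c (x ∷ xs) (x ∷ ys)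

IsCSortingWord : ∀ {n} → CoxeterMatrix n → (c : Word n) → Word n → List (Pos c) → Set
IsCSortingWord {n} M c w0 ps =
  (Linked (_<P_ {c = c}) ps × Reduced M (letters c ps) × letters c ps ≈⟨ M ⟩ w0)
  × (∀ (qs : List (Pos c)) → Linked (_<P_ {c = c}) qs → Reduced M (letters c qs)
       → letters c qs ≈⟨ M ⟩ w0 → LexLeq c ps qs)

deletePos : ∀ {A : Set} (Q : List A) → Subset (length Q) → List A
deletePos []      []            = []
deletePos (q ∷ Q) (inside ∷ P)  = deletePos Q P
deletePos (q ∷ Q) (outside ∷ P) = q ∷ deletePos Q P

IsFace : ∀ {n} → CoxeterMatrix n → (Q : Word n) → Word n → Subset (length Q) → Set
IsFace {n} M Q π P =
  Σ (Word n) λ u → u SL.⊆ deletePos Q P × Reduced M u × u ≈⟨ M ⟩ π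

IsFacet : ∀ {n} → CoxeterMatrix n → (Q : Word n) → Word n → Subset (length Q) → Set
IsFacet M Q π P =
  IsFace M Q π P × (∀ P' → IsFace M Q π P' → P ⊆ˢ P' → P' ⊆ˢ P)

positions : ∀ {m} → Subset m → List (Fin m)
positions []            = []
positions (inside ∷ P)  = F.zero ∷ map F.suc (positions P)
positions (outside ∷ P) = map F.suc (positions P)

-- word for t_i = q_1 ⋯ q_{i-1} q_i q_{i-1} ⋯ q_1  (i is 0-indexed here)
reflWord : ∀ {n} (Q : Word n) → Fin (length Q) → Word n
reflWord Q i = take (toℕ i) Q ++ (lookup Q i ∷ reverse (take (toℕ i) Q))

reflProd : ∀ {n} (Q : Word n) → Subset (length Q) → Word n
reflProd Q P = concat (reverse (map (reflWord Q) (positions P)))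

power : ∀ {n} → Word n → ℕ → Word n
power c k = concat (replicate k c)

-- Deleting the letter at position ℓ of a word q₁ ⋯ qₘ multiplies the element it represents on the
-- left by the reflection t_ℓ = q₁ ⋯ q_{ℓ-1} q_ℓ q_{ℓ-1} ⋯ q₁, so deleting positions ℓ₁ < ⋯ < ℓᵣ from
-- Q = cᵏ w∘(c) leaves a word for t_{ℓ₁} ⋯ t_{ℓᵣ} cᵏ w∘; it represents w∘ exactly when
-- t_{ℓᵣ} ⋯ t_{ℓ₁} = cᵏ. If |P| = kn the complement of P has ℓ(w∘) letters, so it contains a reduced
-- word for w∘ iff it is one; and no face of Δ(Q, w∘) has more than kn elements, so such a face is a
-- facet. Only the fact that w∘(c) is a reduced word for w∘ is used, not that it is the c-sorting word.

module Submission where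

open import Defs
open import Data.Nat using (ℕ; _*_)
open import Data.Fin using (Fin)
open import Data.List using (List; _++_; length; allFin)
open import Data.List.Relation.Binary.Permutation.Propositional using (_↭_)
open import Data.Fin.Subset using (Subset; ∣_∣)
open import Relation.Binary.PropositionalEquality using (_≡_)
open import Function.Bundles using (_⇔_)

open import Level using (0ℓ)
open import Data.Nat using (zero; suc; _+_; _≤_)
open import Data.Nat.Properties
  using (+-comm; +-suc; +-cancelʳ-≡; +-cancelˡ-≤; +-monoˡ-≤; ≤-antisym; ≤-reflexive; ≤-trans; ≤⇒≯; module ≤-Reasoning)
import Data.Fin as Fin
open import Data.List using ([]; _∷_; [_]; map; concat; reverse; take; lookup)
open import Data.List.Properties
  using (++-assoc; ++-identityʳ; ++-monoid; unfold-reverse; reverse-++; reverse-involutive;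
         concat-++; map-∘; map-cong; length-++; length-tabulate)
open import Data.List.Relation.Binary.Permutation.Propositional.Properties using (↭-length)
open import Data.List.Relation.Binary.Pointwise using (Pointwise-≡⇒≡)
import Data.List.Relation.Binary.Sublist.Propositional as Sublist
open import Data.List.Relation.Binary.Sublist.Heterogeneous.Properties using (length-mono-≤; toPointwise)
open import Data.Fin.Subset using (inside; outside; _⊆_)
open import Data.Vec using ([]; _∷_)
open import Data.Fin.Subset.Properties using (_∈?_; p⊂q⇒∣p∣<∣q∣)
open import Data.Product using (_,_)
open import Algebra.Bundles using (Group)
open import Algebra.Structures using (IsGroup)
import Algebra.Properties.Group as GroupProperties
import Algebra.Properties.Monoid as MonoidProperties
import Algebra.Properties.Quasigroup as QuasigroupProperties
open import Relation.Binary.PropositionalEquality as ≡ using (subst₂; module ≡-Reasoning)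
import Relation.Binary.Reasoning.Base.Single as SingleReasoning
open import Relation.Binary.Reasoning.Syntax using (module ≃-syntax)
open import Relation.Nullary using (yes; no; contradiction)
open import Function.Bundles using (mk⇔)
open import Function.Base using (id)
open import Function.Construct.Composition using (_⇔-∘_)
open import Tactic.MonoidSolver using (solve)

reverse-concat : ∀ {A : Set} (xss : List (List A)) →
                 reverse (concat xss) ≡ concat (reverse (map reverse xss))
reverse-concat []         = ≡.refl
reverse-concat (xs ∷ xss) = begin
  reverse (xs ++ concat xss)          ≡⟨ reverse-++ xs (concat xss) ⟩
  reverse (concat xss) ++ reverse xs  ≡⟨ ≡.cong (_++ reverse xs) (reverse-concat xss) ⟩
  concat yss ++ reverse xs            ≡⟨ ≡.cong (concat yss ++_) (++-identityʳ (reverse xs)) ⟨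
  concat yss ++ concat [ reverse xs ] ≡⟨ concat-++ yss [ reverse xs ] ⟩
  concat (yss ++ [ reverse xs ])      ≡⟨ ≡.cong concat (unfold-reverse (reverse xs) (map reverse xss)) ⟨
  concat (reverse (map reverse (xs ∷ xss))) ∎
  where
  open ≡-Reasoning
  yss = reverse (map reverse xss)

reverse-palindrome : ∀ {A : Set} (xs : List A) x →
                     reverse (xs ++ x ∷ reverse xs) ≡ xs ++ x ∷ reverse xs
reverse-palindrome xs x = begin
  reverse (xs ++ x ∷ reverse xs)                ≡⟨ reverse-++ xs (x ∷ reverse xs) ⟩
  reverse (x ∷ reverse xs) ++ reverse xs        ≡⟨ ≡.cong (_++ reverse xs) (unfold-reverse x (reverse xs)) ⟩
  (reverse (reverse xs) ++ [ x ]) ++ reverse xs ≡⟨ ≡.cong (λ ys → (ys ++ [ x ]) ++ reverse xs) (reverse-involutive xs) ⟩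
  (xs ++ [ x ]) ++ reverse xs                   ≡⟨ ++-assoc xs [ x ] (reverse xs) ⟩
  xs ++ x ∷ reverse xs                          ∎
  where open ≡-Reasoning

p⊆q∧∣q∣≤∣p∣⇒q⊆p : ∀ {m} {p q : Subset m} → p ⊆ q → ∣ q ∣ ≤ ∣ p ∣ → q ⊆ p
p⊆q∧∣q∣≤∣p∣⇒q⊆p {p = p} p⊆q ∣q∣≤∣p∣ {x} x∈q with x ∈? p
... | yes x∈p = x∈p
... | no  x∉p = contradiction (p⊂q⇒∣p∣<∣q∣ (p⊆q , x , x∈q , x∉p)) (≤⇒≯ ∣q∣≤∣p∣)

length-deletePos : ∀ {A : Set} (Q : List A) (P : Subset (length Q)) →
                   length (deletePos Q P) + ∣ P ∣ ≡ length Q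
length-deletePos []      []            = ≡.refl
length-deletePos (q ∷ Q) (inside ∷ P)  =
  ≡.trans (+-suc (length (deletePos Q P)) ∣ P ∣) (≡.cong suc (length-deletePos Q P))
length-deletePos (q ∷ Q) (outside ∷ P) = ≡.cong suc (length-deletePos Q P)

length-power : ∀ {n} (c : Word n) k → length (power c k) ≡ k * length c
length-power c zero    = ≡.refl
length-power c (suc k) = ≡.trans (length-++ c) (≡.cong (length c +_) (length-power c k))

module _ {g ℓ} (G : Group g ℓ) where
  open Group G
  open GroupProperties G using (inverseʳ-unique; quasigroup)
  open QuasigroupProperties quasigroup using (cancelʳ)
  open MonoidProperties monoid using (cancelˡ)

  x∙yz≈z⇔x⁻¹≈y : ∀ x y z → x ∙ (y ∙ z) ≈ z ⇔ x ⁻¹ ≈ y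
  x∙yz≈z⇔x⁻¹≈y x y z = mk⇔ to from
    where
    to : x ∙ (y ∙ z) ≈ z → x ⁻¹ ≈ y
    to eq = sym (inverseʳ-unique x y (cancelʳ z (x ∙ y) ε (trans (assoc x y z) (trans eq (sym (identityˡ z))))))
    from : x ⁻¹ ≈ y → x ∙ (y ∙ z) ≈ z
    from eq = trans (∙-congˡ (∙-congʳ (sym eq))) (cancelˡ (inverseʳ x) z)

reflections : ∀ {n} (Q : Word n) → Subset (length Q) → Word n
reflections Q P = concat (map (reflWord Q) (positions P))

reflProd≡reverse-reflections : ∀ {n} (Q : Word n) P → reflProd Q P ≡ reverse (reflections Q P)
reflProd≡reverse-reflections Q P = ≡.sym (begin
  reverse (concat (map t is))                     ≡⟨ reverse-concat (map t is) ⟩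
  concat (reverse (map reverse (map t is)))       ≡⟨ ≡.cong (λ ws → concat (reverse ws)) (map-∘ is) ⟨
  concat (reverse (map (λ i → reverse (t i)) is)) ≡⟨ ≡.cong (λ ws → concat (reverse ws)) (map-cong palindrome is) ⟩
  concat (reverse (map t is))                     ∎)
  where
  open ≡-Reasoning
  t = reflWord Q
  is = positions P
  palindrome : ∀ i → reverse (t i) ≡ t i
  palindrome i = reverse-palindrome (take (Fin.toℕ i) Q) (lookup Q i)

reflWord-suc : ∀ {n} q (Q : Word n) i → reflWord (q ∷ Q) (Fin.suc i) ≡ q ∷ reflWord Q i ++ [ q ]
reflWord-suc q Q i = ≡.cong (q ∷_) (begin
  A ++ lookup Q i ∷ reverse (q ∷ A)       ≡⟨ ≡.cong (λ ws → A ++ lookup Q i ∷ ws) (unfold-reverse q A) ⟩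
  A ++ lookup Q i ∷ (reverse A ++ [ q ])  ≡⟨ ++-assoc A (lookup Q i ∷ reverse A) [ q ] ⟨
  reflWord Q i ++ [ q ]                   ∎)
  where
  open ≡-Reasoning
  A = take (Fin.toℕ i) Q

module _ {n} (M : CoxeterMatrix n) where
  private
    infix 4 _≈_
    _≈_ : Word n → Word n → Set
    u ≈ v = u ≈⟨ M ⟩ v

  open SingleReasoning _≈_ ≈refl ≈trans
    using (begin_; _∎; step-≡-⟩; step-≡-⟨; step-≡-∣; _IsRelatedTo_; ∼-go)
  open ≃-syntax _IsRelatedTo_ _IsRelatedTo_ ∼-go ≈sym

  ≡⇒≈ : ∀ {u v} → u ≡ v → u ≈ v
  ≡⇒≈ ≡.refl = ≈refl

  s∷s∷w≈w : ∀ s w → s ∷ s ∷ w ≈ w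
  s∷s∷w≈w s w = ≈step [] (s ∷ s ∷ []) [] w (invol s)

  ++-congʳ : ∀ w {u v} → u ≈ v → u ++ w ≈ v ++ w
  ++-congʳ w (≈step u x y v r) = subst₂ _≈_ (reassoc x) (reassoc y) (≈step u x y (v ++ w) r)
    where
    reassoc : ∀ x → u ++ x ++ v ++ w ≡ (u ++ x ++ v) ++ w
    reassoc x = ≡.sym (solve (++-monoid (Fin n)))
  ++-congʳ w ≈refl        = ≈refl
  ++-congʳ w (≈sym p)     = ≈sym (++-congʳ w p)
  ++-congʳ w (≈trans p q) = ≈trans (++-congʳ w p) (++-congʳ w q)

  ++-congˡ : ∀ w {u v} → u ≈ v → w ++ u ≈ w ++ v
  ++-congˡ w (≈step u x y v r) =
    subst₂ _≈_ (++-assoc w u (x ++ v)) (++-assoc w u (y ++ v)) (≈step (w ++ u) x y v r)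
  ++-congˡ w ≈refl        = ≈refl
  ++-congˡ w (≈sym p)     = ≈sym (++-congˡ w p)
  ++-congˡ w (≈trans p q) = ≈trans (++-congˡ w p) (++-congˡ w q)

  ++-cong : ∀ {u u′ v v′} → u ≈ u′ → v ≈ v′ → u ++ v ≈ u′ ++ v′
  ++-cong {u′ = u′} {v} p q = ≈trans (++-congʳ v p) (++-congˡ u′ q)

  ++-reverseʳ : ∀ w → w ++ reverse w ≈ []
  ++-reverseʳ []      = ≈refl
  ++-reverseʳ (s ∷ w) = begin
    s ∷ w ++ reverse (s ∷ w)      ≡⟨ ≡.cong (λ r → s ∷ w ++ r) (unfold-reverse s w) ⟩
    s ∷ w ++ reverse w ++ [ s ]   ≡⟨ ≡.cong (s ∷_) (++-assoc w (reverse w) [ s ]) ⟨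
    s ∷ (w ++ reverse w) ++ [ s ] ≃⟨ ++-congˡ [ s ] (++-congʳ [ s ] (++-reverseʳ w)) ⟩
    s ∷ s ∷ []                    ≃⟨ s∷s∷w≈w s [] ⟩
    []                            ∎

  ++-reverseˡ : ∀ w → reverse w ++ w ≈ []
  ++-reverseˡ w = subst₂ _≈_ (≡.cong (reverse w ++_) (reverse-involutive w)) ≡.refl (++-reverseʳ (reverse w))

  reverse-cong : ∀ {u v} → u ≈ v → reverse u ≈ reverse v
  reverse-cong {u} {v} u≈v = begin
    reverse u                     ≡⟨ ++-identityʳ (reverse u) ⟨
    reverse u ++ []               ≃⟨ ++-congˡ (reverse u) (++-reverseʳ v) ⟨
    reverse u ++ v ++ reverse v   ≃⟨ ++-congˡ (reverse u) (++-congʳ (reverse v) u≈v) ⟨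
    reverse u ++ u ++ reverse v   ≡⟨ ++-assoc (reverse u) u (reverse v) ⟨
    (reverse u ++ u) ++ reverse v ≃⟨ ++-congʳ (reverse v) (++-reverseˡ u) ⟩
    reverse v                     ∎

  isGroup : IsGroup _≈_ _++_ [] reverse
  isGroup = record
    { isMonoid = record
      { isSemigroup = record
        { isMagma = record
          { isEquivalence = record { refl = ≈refl ; sym = ≈sym ; trans = ≈trans }
          ; ∙-cong        = ++-cong
          }
        ; assoc = λ u v w → ≡⇒≈ (++-assoc u v w)
        }
      ; identity = (λ _ → ≈refl) , (λ u → ≡⇒≈ (++-identityʳ u))
      }
    ; inverse = ++-reverseˡ , ++-reverseʳ
    ; ⁻¹-cong = reverse-cong
    }

  coxeterGroup : Group 0ℓ 0ℓ
  coxeterGroup = record { isGroup = isGroup }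

  concat-conjugate : ∀ g (ws : List (Word n)) →
                     concat (map (λ w → g ++ w ++ reverse g) ws) ≈ g ++ concat ws ++ reverse g
  concat-conjugate g []       = ≈sym (++-reverseʳ g)
  concat-conjugate g (w ∷ ws) = begin
    (g ++ w ++ g⁻¹) ++ concat (map (λ v → g ++ v ++ g⁻¹) ws) ≃⟨ ++-congˡ (g ++ w ++ g⁻¹) (concat-conjugate g ws) ⟩
    (g ++ w ++ g⁻¹) ++ (g ++ concat ws ++ g⁻¹)              ≡⟨ solve (++-monoid (Fin n)) ⟩
    (g ++ w) ++ (g⁻¹ ++ g) ++ (concat ws ++ g⁻¹)            ≃⟨ ++-congˡ (g ++ w) (++-congʳ (concat ws ++ g⁻¹) (++-reverseˡ g)) ⟩
    (g ++ w) ++ concat ws ++ g⁻¹                            ≡⟨ solve (++-monoid (Fin n)) ⟩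
    g ++ (w ++ concat ws) ++ g⁻¹                            ∎
    where g⁻¹ = reverse g

  reflections-suc : ∀ q (Q : Word n) (is : List (Fin (length Q))) →
                    concat (map (reflWord (q ∷ Q)) (map Fin.suc is)) ≈ q ∷ concat (map (reflWord Q) is) ++ [ q ]
  reflections-suc q Q is = begin
    concat (map (reflWord (q ∷ Q)) (map Fin.suc is))               ≡⟨ ≡.cong concat (map-∘ is) ⟨
    concat (map (λ i → reflWord (q ∷ Q) (Fin.suc i)) is)           ≡⟨ ≡.cong concat (map-cong (reflWord-suc q Q) is) ⟩
    concat (map (λ i → q ∷ reflWord Q i ++ [ q ]) is)              ≡⟨ ≡.cong concat (map-∘ is) ⟩
    concat (map (λ w → [ q ] ++ w ++ [ q ]) (map (reflWord Q) is)) ≃⟨ concat-conjugate [ q ] (map (reflWord Q) is) ⟩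
    q ∷ concat (map (reflWord Q) is) ++ [ q ]                      ∎

  qXq∙qQ≈qXQ : ∀ q X Q → (q ∷ X ++ [ q ]) ++ q ∷ Q ≈ q ∷ X ++ Q
  qXq∙qQ≈qXQ q X Q = ≈trans (≡⇒≈ (≡.cong (q ∷_) (++-assoc X [ q ] (q ∷ Q)))) (++-congˡ (q ∷ X) (s∷s∷w≈w q Q))

  deletePos≈reflections++ : ∀ (Q : Word n) P → deletePos Q P ≈ reflections Q P ++ Q
  deletePos≈reflections++ []      []            = ≈refl
  deletePos≈reflections++ (q ∷ Q) (outside ∷ P) = begin
    q ∷ deletePos Q P                            ≃⟨ ++-congˡ [ q ] (deletePos≈reflections++ Q P) ⟩
    q ∷ reflections Q P ++ Q                     ≃⟨ qXq∙qQ≈qXQ q (reflections Q P) Q ⟨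
    (q ∷ reflections Q P ++ [ q ]) ++ q ∷ Q      ≃⟨ ++-congʳ (q ∷ Q) (reflections-suc q Q (positions P)) ⟨
    reflections (q ∷ Q) (outside ∷ P) ++ q ∷ Q   ∎
  deletePos≈reflections++ (q ∷ Q) (inside ∷ P) = begin
    deletePos Q P                                ≃⟨ deletePos≈reflections++ Q P ⟩
    reflections Q P ++ Q                         ≃⟨ s∷s∷w≈w q _ ⟨
    q ∷ q ∷ reflections Q P ++ Q                 ≃⟨ ++-congˡ [ q ] (qXq∙qQ≈qXQ q (reflections Q P) Q) ⟨
    q ∷ (q ∷ reflections Q P ++ [ q ]) ++ q ∷ Q  ≃⟨ ++-congˡ [ q ] (++-congʳ (q ∷ Q) (reflections-suc q Q (positions P))) ⟨
    reflections (q ∷ Q) (inside ∷ P) ++ q ∷ Q    ∎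

  ≈-resp₂-⇔ : ∀ {u u′ v v′} → u ≈ u′ → v ≈ v′ → (u ≈ v) ⇔ (u′ ≈ v′)
  ≈-resp₂-⇔ u≈u′ v≈v′ = mk⇔ (λ u≈v → ≈trans (≈sym u≈u′) (≈trans u≈v v≈v′))
                           (λ u′≈v′ → ≈trans u≈u′ (≈trans u′≈v′ (≈sym v≈v′)))

  deletePos≈⇔reflProd≈ : ∀ C L {π} → L ≈ π → (P : Subset (length (C ++ L))) →
                          deletePos (C ++ L) P ≈ π ⇔ reflProd (C ++ L) P ≈ C
  deletePos≈⇔reflProd≈ C L L≈π P =
    ≡.subst (λ w → R ++ C ++ L ≈ L ⇔ w ≈ C) (≡.sym (reflProd≡reverse-reflections (C ++ L) P))
            (x∙yz≈z⇔x⁻¹≈y coxeterGroup R C L)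
    ⇔-∘ ≈-resp₂-⇔ (deletePos≈reflections++ (C ++ L) P) (≈sym L≈π)
    where R = reflections (C ++ L) P

  reduced-≈⇒length-≡ : ∀ {u v} → Reduced M u → Reduced M v → u ≈ v → length u ≡ length v
  reduced-≈⇒length-≡ {u} {v} u-reduced v-reduced u≈v = ≤-antisym (u-reduced v (≈sym u≈v)) (v-reduced u u≈v)

module _ {n} (M : CoxeterMatrix n) {π : Word n} (π-reduced : Reduced M π) where
  face-size : ∀ Q P → IsFace M Q π P → length π + ∣ P ∣ ≤ length Q
  face-size Q P (u , u⊆Q∖P , _ , u≈π) = begin
    length π + ∣ P ∣               ≤⟨ +-monoˡ-≤ ∣ P ∣ (π-reduced u u≈π) ⟩
    length u + ∣ P ∣               ≤⟨ +-monoˡ-≤ ∣ P ∣ (length-mono-≤ u⊆Q∖P) ⟩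
    length (deletePos Q P) + ∣ P ∣ ≡⟨ length-deletePos Q P ⟩
    length Q                       ∎
    where open ≤-Reasoning

  isFacet⇔deletePos≈ : ∀ Q P → length π + ∣ P ∣ ≡ length Q → IsFacet M Q π P ⇔ deletePos Q P ≈⟨ M ⟩ π
  isFacet⇔deletePos≈ Q P size = mk⇔ to from
    where
    length-Q∖P : length (deletePos Q P) ≡ length π
    length-Q∖P = +-cancelʳ-≡ ∣ P ∣ _ _ (≡.trans (length-deletePos Q P) (≡.sym size))

    to : IsFacet M Q π P → deletePos Q P ≈⟨ M ⟩ π
    to ((u , u⊆Q∖P , _ , u≈π) , _) = ≡.subst (_≈⟨ M ⟩ π) u≡Q∖P u≈π
      where
      u≡Q∖P : u ≡ deletePos Q P
      u≡Q∖P = Pointwise-≡⇒≡ (toPointwise (≤-antisym (length-mono-≤ u⊆Q∖P)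
                                                    (≤-trans (≤-reflexive length-Q∖P) (π-reduced u u≈π))) u⊆Q∖P)

    from : deletePos Q P ≈⟨ M ⟩ π → IsFacet M Q π P
    from Q∖P≈π = (deletePos Q P , Sublist.⊆-refl , Q∖P-reduced , Q∖P≈π) , maximal
      where
      Q∖P-reduced : Reduced M (deletePos Q P)
      Q∖P-reduced v v≈Q∖P = ≤-trans (≤-reflexive length-Q∖P) (π-reduced v (≈trans v≈Q∖P Q∖P≈π))
      maximal : ∀ P′ → IsFace M Q π P′ → P ⊆ P′ → P′ ⊆ P
      maximal P′ face P⊆P′ = p⊆q∧∣q∣≤∣p∣⇒q⊆p P⊆P′
        (+-cancelˡ-≤ (length π) ∣ P′ ∣ ∣ P ∣ (≤-trans (face-size Q P′ face) (≤-reflexive (≡.sym size))))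

proposition2p8 : ∀ {n} (M : CoxeterMatrix n) → FiniteW M
    → (c : Word n) → c ↭ allFin n
    → (k : ℕ)
    → (w0 : Word n) → IsLongest M w0
    → (ps : List (Pos c)) → IsCSortingWord M c w0 ps
    → (P : Subset (length (power c k ++ letters c ps)))
    → ∣ P ∣ ≡ k * n
    → IsFacet M (power c k ++ letters c ps) w0 P
      ⇔ (reflProd (power c k ++ letters c ps) P ≈⟨ M ⟩ power c k)
proposition2p8 {n} M _ c c↭S k w0 (w0-reduced , _) ps ((_ , L-reduced , L≈w0) , _) P ∣P∣≡kn =
  deletePos≈⇔reflProd≈ M C L L≈w0 P ⇔-∘ isFacet⇔deletePos≈ M w0-reduced (C ++ L) P size
  where
  open ≡-Reasoning
  C = power c k
  L = letters c ps
  size : length w0 + ∣ P ∣ ≡ length (C ++ L)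
  size = begin
    length w0 + ∣ P ∣        ≡⟨ ≡.cong₂ _+_ (reduced-≈⇒length-≡ M w0-reduced L-reduced (≈sym L≈w0)) ∣P∣≡kn ⟩
    length L + k * n         ≡⟨ +-comm (length L) (k * n) ⟩
    k * n + length L         ≡⟨ ≡.cong (λ m → k * m + length L) (≡.trans (↭-length c↭S) (length-tabulate id)) ⟨
    k * length c + length L  ≡⟨ ≡.cong (_+ length L) (length-power c k) ⟨
    length C + length L      ≡⟨ length-++ C ⟨
    length (C ++ L)          ∎
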